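{- Let $t$ be a term with $\mathrm{normal}(t)$, and let $\Phi$ be a derivation in the CbN type system of $\Gamma\vdash^{(m,e)} t:\mathsf{normal}$. Then $\Gamma$ is empty (so $\Phi$ is tight) and $m=e=0$.
   Context: Terms: $t,s ::= x \mid \lambda x.t \mid t\,s \mid t[x\leftarrow s]$, where $t[x\leftarrow s]$ (explicit substitution) binds $x$ in $t$. $\mathrm{normal}$: least predicate with $\mathrm{normal}(\lambda x.t)$ and $\mathrm{normal}(t)\Rightarrow\mathrm{normal}(t[x\leftarrow s])$. CbN types: linear types $L ::= \mathsf{normal}\mid M\to L$; multi types $M ::= [L_i]_{i\in J}$ finite multisets, $\mathbf 0$ the empty multiset, $\uplus$ union. Type contexts $\Gamma$ map variables to multi types, all but finitely many to $\mathbf 0$; $\mathrm{dom}(\Gamma)=\{x\mid\Gamma(x)\neq\mathbf 0\}$; $\Gamma$ is empty if its domain is empty; $\uplus$ pointwise; $\Gamma,x:M$ means $\Gamma\uplus(x\mapsto M)$ with $x\notin\mathrm{dom}(\Gamma)$; $\Gamma\setminus\!\!\setminus x$ is $\Gamma$ with $x$ mapped to $\mathbf 0$. Rules: (ax) $x:[L]\vdash^{(0,1)} x:L$; (normal) $\vdash^{(0,0)}\lambda x.t:\mathsf{normal}$; (fun) from $\Gamma\vdash^{(m,e)} t:L$ infer $\Gamma\setminus\!\!\setminus x\vdash^{(m,e)}\lambda x.t:\Gamma(x)\to L$; (many) from $\Pi_i\vdash^{(m_i,e_i)} t:L_i$ for $i\in J$ ($J$ finite, possibly empty) infer $\biguplus_i\Pi_i\vdash^{(\sum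 m_i,\sum e_i)} t:[L_i]_{i\in J}$; (app) from $\Gamma\vdash^{(m,e)} t:M\to L$ and $\Pi\vdash^{(m',e')} s:M$ infer $\Gamma\uplus\Pi\vdash^{(m+m'+1,e+e')} t\,s:L$; (ES) from $\Gamma,x:M\vdash^{(m,e)} t:L$ and $\Pi\vdash^{(m',e')} s:M$ infer $\Gamma\uplus\Pi\vdash^{(m+m',e+e')} t[x\leftarrow s]:L$. A derivation of $\Gamma\vdash^{(m,e)} t:L$ is tight if $L=\mathsf{normal}$ and $\Gamma$ is empty. -}

module Defs where

open import Data.Nat using (ℕ; zero; suc; _+_; _≟_)
open import Data.List using (List; []; _∷_; _++_)
open import Relation.Nullary using (yes; no)

Var : Set
Var = ℕ

data Term : Set where
  var : Var → Term
  lam : Var → Term → Term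
  app : Term → Term → Term
  es  : Term → Var → Term → Term    -- t[x←s]

data Normal : Term → Set where
  normal-lam : ∀ {x t} → Normal (lam x t)
  normal-es  : ∀ {t x s} → Normal t → Normal (es t x s)

-- CbN types.  Multi types (finite multisets) are represented as lists,
-- identified up to permutation by the equivalences below.
mutual
  data LType : Set where
    normal : LType
    _⇒_    : MType → LType → LType

  MType : Set
  MType = List LType

mutual
  data _≈L_ : LType → LType → Set where
    normal≈ : normal ≈L normal
    ⇒≈      : ∀ {M M' L L'} → M ≈M M' → L ≈L L' → (M ⇒ L) ≈L (M' ⇒ L')

  data _≈M_ : MType → MType → Set where
    []≈    : [] ≈M []
    ∷≈     : ∀ {L L' M M'} → L ≈L L' → M ≈M M' → (L ∷ M) ≈M (L' ∷ M')
    swap≈  : ∀ {L L' M} → (L ∷ L' ∷ M) ≈M (L' ∷ L ∷ M)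
    trans≈ : ∀ {M M' M''} → M ≈M M' → M' ≈M M'' → M ≈M M''

-- Type contexts: variables to multi types (the empty list is 𝟎).
Ctx : Set
Ctx = Var → MType

∅ : Ctx
∅ _ = []

_⊎_ : Ctx → Ctx → Ctx
(Γ ⊎ Δ) y = Γ y ++ Δ y

_[_↦_] : Ctx → Var → MType → Ctx
(Γ [ x ↦ M ]) y with y ≟ x
... | yes _ = M
... | no  _ = Γ y

_∖∖_ : Ctx → Var → Ctx
Γ ∖∖ x = Γ [ x ↦ [] ]

_≈C_ : Ctx → Ctx → Set
Γ ≈C Δ = ∀ y → Γ y ≈M Δ y

Empty : Ctx → Set
Empty Γ = ∀ y → Γ y ≡ []
  where open import Relation.Binary.PropositionalEquality using (_≡_)

mutual
  data _⊢⟨_,_⟩_∶_ : Ctx → ℕ → ℕ → Term → LType → Set where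
    ax     : ∀ {x L} → (∅ [ x ↦ L ∷ [] ]) ⊢⟨ 0 , 1 ⟩ var x ∶ L
    normalR : ∀ {x t} → ∅ ⊢⟨ 0 , 0 ⟩ lam x t ∶ normal
    fun    : ∀ {Γ m e x t L} → Γ ⊢⟨ m , e ⟩ t ∶ L →
             (Γ ∖∖ x) ⊢⟨ m , e ⟩ lam x t ∶ (Γ x ⇒ L)
    appR   : ∀ {Γ Π m e m' e' t s M L} →
             Γ ⊢⟨ m , e ⟩ t ∶ (M ⇒ L) → Π ⊩⟨ m' , e' ⟩ s ∶ M →
             (Γ ⊎ Π) ⊢⟨ suc (m + m') , e + e' ⟩ app t s ∶ L
    -- premise context is Δ = Γ , x : M  with M = Δ x and Γ = Δ ∖∖ x
    esR    : ∀ {Δ Π m e m' e' t x s L} →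
             Δ ⊢⟨ m , e ⟩ t ∶ L → Π ⊩⟨ m' , e' ⟩ s ∶ Δ x →
             ((Δ ∖∖ x) ⊎ Π) ⊢⟨ m + m' , e + e' ⟩ es t x s ∶ L
    -- multisets are identified up to permutation
    conv   : ∀ {Γ Γ' m e t L L'} → Γ ⊢⟨ m , e ⟩ t ∶ L → Γ ≈C Γ' → L ≈L L' →
             Γ' ⊢⟨ m , e ⟩ t ∶ L'

  data _⊩⟨_,_⟩_∶_ : Ctx → ℕ → ℕ → Term → MType → Set where
    many[] : ∀ {t} → ∅ ⊩⟨ 0 , 0 ⟩ t ∶ []
    many∷  : ∀ {Γ Π m e m' e' t L M} →
             Γ ⊢⟨ m , e ⟩ t ∶ L → Π ⊩⟨ m' , e' ⟩ t ∶ M →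
             (Γ ⊎ Π) ⊩⟨ m + m' , e + e' ⟩ t ∶ (L ∷ M)

module Submission where

-- A derivation of  Γ ⊢⟨ m , e ⟩ t ∶ normal  for a normal term t is built from
-- three rules only: (normal) for the abstraction at the head, (ES) for each
-- explicit substitution around it, and (conv) for permutations of multisets.
-- (fun) is excluded since it yields an arrow type, and (app)/(ax) since
-- normal terms are neither applications nor variables.  By induction on the
-- derivation, the body of an ES is typed with an empty context, so the
-- substituted variable receives the empty multi type 𝟎; the argument is then
-- typed by (many) over the empty family, which contributes an empty context
-- and zero counters.  Permutation equivalence preserves emptiness.

open import Defs
open import Data.Nat using (ℕ; _≟_)
open import Data.List using ([])
open import Data.Product using (_×_; _,_)
open import Relation.Nullary using (yes; no)
open import Relation.Binary.PropositionalEquality using (_≡_; refl)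

Free : Ctx → ℕ → ℕ → Set
Free Γ m e = Empty Γ × (m ≡ 0) × (e ≡ 0)

≈L-normal : ∀ {L L'} → L ≈L L' → L' ≡ normal → L ≡ normal
≈L-normal normal≈  refl = refl
≈L-normal (⇒≈ _ _) ()

≈M-empty : ∀ {M M'} → M ≈M M' → M ≡ [] → M' ≡ []
≈M-empty []≈          refl = refl
≈M-empty (∷≈ _ _)     ()
≈M-empty swap≈        ()
≈M-empty (trans≈ p q) eq   = ≈M-empty q (≈M-empty p eq)

≈C-empty : ∀ {Γ Γ'} → Γ ≈C Γ' → Empty Γ → Empty Γ'
≈C-empty Γ≈Γ' emptyΓ y = ≈M-empty (Γ≈Γ' y) (emptyΓ y)

many-empty-free : ∀ {Π m e s M} → Π ⊩⟨ m , e ⟩ s ∶ M → M ≡ [] → Free Π m e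
many-empty-free many[]      refl = (λ _ → refl) , refl , refl
many-empty-free (many∷ _ _) ()

es-ctx-empty : ∀ {Δ Π} x → Empty Δ → Empty Π → Empty ((Δ ∖∖ x) ⊎ Π)
es-ctx-empty {Δ} x emptyΔ emptyΠ y with y ≟ x
... | yes _ = emptyΠ y
... | no  _ rewrite emptyΔ y = emptyΠ y

normal-free : ∀ {t Γ m e L} → Normal t → Γ ⊢⟨ m , e ⟩ t ∶ L → L ≡ normal →
              Free Γ m e
normal-free nt (conv d Γ≈Γ' L≈L') eq with normal-free nt d (≈L-normal L≈L' eq)
... | emptyΓ , m≡0 , e≡0 = ≈C-empty Γ≈Γ' emptyΓ , m≡0 , e≡0
normal-free normal-lam      normalR refl = (λ _ → refl) , refl , refl
normal-free normal-lam      (fun _) ()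
normal-free (normal-es nt) (esR {x = x} body arg) eq
  with normal-free nt body eq
... | emptyΔ , refl , refl with many-empty-free arg (emptyΔ x)
...   | emptyΠ , refl , refl = es-ctx-empty x emptyΔ emptyΠ , refl , refl

proposition3 : ∀ {t : Term} {Γ : Ctx} {m e : ℕ} → Normal t →
    Γ ⊢⟨ m , e ⟩ t ∶ normal → Empty Γ × (m ≡ 0) × (e ≡ 0)
proposition3 nt d = normal-free nt d refl
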